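{- Let $H$ be a graph of order $n$ and let $r\ge 1$. If $H$ is partitionable into two global offensive alliances, then $$\gamma_o(K_{r}\Box H)\le \left\lfloor\frac{rn}{2}\right\rfloor.$$
   Context: All graphs are finite and simple; $K_r$ is the complete graph on $r$ vertices. For a graph with vertex set $V$, a vertex $v$ and $S\subseteq V$, let $\delta_S(v)=|N(v)\cap S|$ and $\overline{S}=V\setminus S$. A nonempty set $S\subseteq V$ is a global offensive alliance if $\delta_S(v)\ge \delta_{\overline{S}}(v)+1$ for every $v\in\overline{S}$; $\gamma_o(G)$ is the minimum cardinality of a global offensive alliance of $G$. $H$ is partitionable into two global offensive alliances if there is a partition $\{Y_1,Y_2\}$ of $V(H)$ with both $Y_1$ and $Y_2$ global offensive alliances of $H$. $G\Box H$ is the Cartesian product: vertex set $V(G)\times V(H)$, with $(a,b)\sim(c,d)$ iff ($a=c$ and $b\sim d$ in $H$) or ($a\sim c$ in $G$ and $b=d$). -}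

module Defs where

open import Data.Nat using (ℕ; zero; suc; _+_; _*_; _≤_; _<_)
open import Data.Nat.DivMod using (_/_)
open import Data.Bool using (Bool; true; false; _∧_; _∨_; not; if_then_else_)
open import Data.Fin using (Fin; remQuot)
open import Data.Fin.Subset using (Subset; _∈_; _∉_; ∣_∣; Nonempty; ∁)
open import Data.Vec using (lookup)
open import Data.Vec.Functional using (Vector)
open import Data.Product using (Σ; _×_; _,_; proj₁; proj₂)
open import Relation.Binary.PropositionalEquality using (_≡_; _≢_)

record Graph (n : ℕ) : Set where
  field
    adj   : Fin n → Fin n → Bool
    sym   : ∀ u v → adj u v ≡ adj v u
    irrefl : ∀ v → adj v v ≡ false
open Graph public

count : ∀ {n} → (Fin n → Bool) → ℕ
count {zero}  f = 0
count {suc n} f = (if f Fin.zero then 1 else 0) + count (λ i → f (Fin.suc i))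
  where import Data.Fin as Fin

mem : ∀ {n} → Subset n → Fin n → Bool
mem S v with lookup S v
... | Data.Fin.Subset.inside  = true
... | Data.Fin.Subset.outside = false

δ : ∀ {n} → Graph n → Subset n → Fin n → ℕ
δ G S v = count (λ u → adj G v u ∧ mem S u)

IsGOA : ∀ {n} → Graph n → Subset n → Set
IsGOA G S = Nonempty S × (∀ v → v ∉ S → δ G (∁ S) v + 1 ≤ δ G S v)

PartitionableIntoTwoGOA : ∀ {n} → Graph n → Set
PartitionableIntoTwoGOA H = Σ (Subset _) λ Y → IsGOA H Y × IsGOA H (∁ Y)

-- γ_o(G) ≤ k  :⇔  there is a global offensive alliance of cardinality ≤ k
-- (γ_o is the minimum cardinality of a GOA)
γo≤ : ∀ {n} → Graph n → ℕ → Set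
γo≤ G k = Σ (Subset _) λ S → IsGOA G S × ∣ S ∣ ≤ k

complete : (r : ℕ) → Graph r
complete r = record { adj = λ u v → not (eqF u v) ; sym = symF ; irrefl = irr }
  where
    open import Data.Fin using (_≟_)
    open import Relation.Nullary using (does)
    open import Relation.Binary.PropositionalEquality using (refl)
    eqF : Fin r → Fin r → Bool
    eqF u v = does (u ≟ v)
    symF : ∀ u v → not (eqF u v) ≡ not (eqF v u)
    symF u v with u ≟ v | v ≟ u
    ... | Relation.Nullary.yes _ | Relation.Nullary.yes _ = refl
    ... | Relation.Nullary.no _  | Relation.Nullary.no _  = refl
    ... | Relation.Nullary.yes p | Relation.Nullary.no q  = Data.Empty.⊥-elim (q (Relation.Binary.PropositionalEquality.sym p))
      where import Data.Empty
    ... | Relation.Nullary.no p  | Relation.Nullary.yes q = Data.Empty.⊥-elim (p (Relation.Binary.PropositionalEquality.sym q))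
      where import Data.Empty
    irr : ∀ v → not (eqF v v) ≡ false
    irr v with v ≟ v
    ... | Relation.Nullary.yes _ = refl
    ... | Relation.Nullary.no ¬p = Data.Empty.⊥-elim (¬p refl)
      where import Data.Empty

-- Cartesian product G □ H on Fin (m * n); vertex i ↔ (a , b) = remQuot n i
_□_ : ∀ {m n} → Graph m → Graph n → Graph (m * n)
_□_ {m} {n} G H = record { adj = A ; sym = S ; irrefl = I }
  where
    open import Data.Fin using (_≟_)
    open import Relation.Nullary using (does; yes; no)
    open import Relation.Binary.PropositionalEquality using (refl; cong₂)
    import Relation.Binary.PropositionalEquality as Eq
    import Data.Empty
    eq : ∀ {k} → Fin k → Fin k → Bool
    eq u v = does (u ≟ v)
    eq-sym : ∀ {k} (u v : Fin k) → eq u v ≡ eq v u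
    eq-sym u v with u ≟ v | v ≟ u
    ... | yes _ | yes _ = refl
    ... | no _  | no _  = refl
    ... | yes p | no q  = Data.Empty.⊥-elim (q (Eq.sym p))
    ... | no p  | yes q = Data.Empty.⊥-elim (p (Eq.sym q))
    eq-refl : ∀ {k} (u : Fin k) → eq u u ≡ true
    eq-refl u with u ≟ u
    ... | yes _ = refl
    ... | no ¬p = Data.Empty.⊥-elim (¬p refl)
    A' : Fin m × Fin n → Fin m × Fin n → Bool
    A' (a , b) (c , d) = (eq a c ∧ adj H b d) ∨ (adj G a c ∧ eq b d)
    A : Fin (m * n) → Fin (m * n) → Bool
    A i j = A' (remQuot n i) (remQuot n j)
    S' : ∀ x y → A' x y ≡ A' y x
    S' (a , b) (c , d) rewrite eq-sym a c | Graph.sym H b d | Graph.sym G a c | eq-sym b d = refl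
    I' : ∀ x → A' x x ≡ false
    I' (a , b) rewrite eq-refl a | Graph.irrefl H b | Graph.irrefl G a = refl
    S : ∀ i j → A i j ≡ A j i
    S i j = S' (remQuot n i) (remQuot n j)
    I : ∀ i → A i i ≡ false
    I i = I' (remQuot n i)

-- Let {Y, V ∖ Y} be the partition with |Y| ≤ |V ∖ Y|, and take Y in the
-- even-indexed copies of H and V ∖ Y in the odd-indexed ones.  A vertex (a , b)
-- outside this set has more neighbours inside than outside within its copy of H,
-- because the set of that copy is an offensive alliance of H; within its copy of
-- K_r the set meets exactly the copies of the other parity, and the two parity
-- classes differ in size by at most one.  The set has ⌈r/2⌉|Y| + ⌊r/2⌋|V ∖ Y|
-- ≤ ⌊rn/2⌋ vertices.
module Submission where

open import Defs hiding (sym)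
open import Data.Nat using (ℕ; _*_; _≤_)
open import Data.Nat.DivMod using (_/_)

open import Data.Bool using (Bool; true; false; _∧_; _∨_; not; _xor_; if_then_else_)
open import Data.Bool.Properties using (not-involutive; not-injective; ∨-identityʳ; xor-comm)
open import Data.Empty using (⊥-elim)
open import Data.Fin using (Fin; zero; suc; remQuot; combine; fromℕ<; _↑ˡ_; _↑ʳ_)
open import Data.Fin.Properties using (_≟_; splitAt-↑ˡ; splitAt-↑ʳ; remQuot-combine)
open import Data.Fin.Subset using (Subset; _∈_; _∉_; ∣_∣; ∁)
open import Data.Nat using (_+_; _≤?_)
open import Data.Nat.DivMod using (m*n/n≡m; /-monoˡ-≤)
open import Data.Nat.Properties
  using (+-identityʳ; +-assoc; +-comm; +-suc; +-mono-≤; +-monoʳ-≤; ≤-reflexive; ≤-trans; ≤-pred; n≤1+n;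
         ≰⇒≥; module ≤-Reasoning; +-commutativeSemigroup; +-0-commutativeMonoid)
open import Data.Nat.Tactic.RingSolver using (solve-∀)
open import Algebra.Properties.CommutativeSemigroup +-commutativeSemigroup
  using (x∙yz≈y∙xz; xy∙z≈xz∙y)
open import Algebra.Properties.CommutativeMonoid.Sum +-0-commutativeMonoid
  using (sum-syntax; sum-cong-≗; sum-replicate-zero; ∑-distrib-+)
open import Data.Product using (∃; _×_; _,_; proj₁; proj₂; map₁; map₂)
open import Data.Sum using (_⊎_; inj₁; inj₂)
open import Data.Vec using (lookup; tabulate)
open import Data.Vec.Properties using (lookup∘tabulate; lookup-map; []=⇒lookup; lookup⇒[]=)
open import Function using (_∘_; const)
open import Relation.Nullary using (does; yes; no)
open import Relation.Binary.PropositionalEquality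
  using (_≡_; _≗_; refl; sym; trans; cong; cong₂; subst; subst₂; module ≡-Reasoning)

indicator : Bool → ℕ
indicator b = if b then 1 else 0

count-cong : ∀ {n} {f g : Fin n → Bool} → f ≗ g → count f ≡ count g
count-cong {ℕ.zero}  f≗g = refl
count-cong {ℕ.suc n} f≗g = cong₂ _+_ (cong indicator (f≗g zero)) (count-cong (f≗g ∘ suc))

count-false : ∀ n → count {n} (const false) ≡ 0
count-false ℕ.zero    = refl
count-false (ℕ.suc n) = count-false n

count-compl : ∀ {n} (f : Fin n → Bool) → count f + count (not ∘ f) ≡ n
count-compl {ℕ.zero}  f = refl
count-compl {ℕ.suc n} f with f zero
... | true  = cong ℕ.suc (count-compl (f ∘ suc))
... | false = trans (+-suc _ _) (cong ℕ.suc (count-compl (f ∘ suc)))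

count-point : ∀ {n} (b : Fin n) (g : Fin n → Bool) → count (λ d → does (b ≟ d) ∧ g d) ≡ indicator (g b)
count-point {ℕ.suc n} zero    g = trans (cong (indicator (g zero) +_) (count-false n)) (+-identityʳ _)
count-point {ℕ.suc n} (suc b) g = count-point b (g ∘ suc)

count-↑ : ∀ m {k} (f : Fin (m + k) → Bool) → count f ≡ count (f ∘ (_↑ˡ k)) + count (f ∘ (m ↑ʳ_))
count-↑ ℕ.zero    f = refl
count-↑ (ℕ.suc m) f =
  trans (cong (indicator (f zero) +_) (count-↑ m (f ∘ suc))) (sym (+-assoc (indicator (f zero)) _ _))

count-remQuot : ∀ r {n} (Φ : Fin r × Fin n → Bool) →
                count (Φ ∘ remQuot {r} n) ≡ ∑[ c < r ] count (λ d → Φ (c , d))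
count-remQuot ℕ.zero    Φ = refl
count-remQuot (ℕ.suc r) {n} Φ = begin
  count (Φ ∘ remQuot n)
    ≡⟨ count-↑ n _ ⟩
  count (Φ ∘ remQuot n ∘ (_↑ˡ r * n)) + count (Φ ∘ remQuot n ∘ (n ↑ʳ_))
    ≡⟨ cong₂ _+_ (count-cong (cong Φ ∘ remQuot-↑ˡ)) (count-cong (cong Φ ∘ remQuot-↑ʳ)) ⟩
  count (λ d → Φ (zero , d)) + count (Φ ∘ map₁ suc ∘ remQuot n)
    ≡⟨ cong (count (λ d → Φ (zero , d)) +_) (count-remQuot r (Φ ∘ map₁ suc)) ⟩
  ∑[ c < ℕ.suc r ] count (λ d → Φ (c , d))
    ∎
  where
  open ≡-Reasoning
  remQuot-↑ˡ : ∀ j → remQuot {ℕ.suc r} n (j ↑ˡ r * n) ≡ (zero , j)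
  remQuot-↑ˡ j rewrite splitAt-↑ˡ n j (r * n) = refl
  remQuot-↑ʳ : ∀ j → remQuot {ℕ.suc r} n (n ↑ʳ j) ≡ map₁ suc (remQuot {r} n j)
  remQuot-↑ʳ j rewrite splitAt-↑ʳ n (r * n) j = refl

sum-indicator : ∀ {r} (g : Fin r → Bool) → ∑[ c < r ] indicator (g c) ≡ count g
sum-indicator {ℕ.zero}  g = refl
sum-indicator {ℕ.suc r} g = cong (indicator (g zero) +_) (sum-indicator (g ∘ suc))

sum-point : ∀ {r} (a : Fin r) x → ∑[ c < r ] (if does (a ≟ c) then x else 0) ≡ x
sum-point {ℕ.suc r} zero    x = trans (cong (x +_) (sum-replicate-zero r)) (+-identityʳ x)
sum-point {ℕ.suc r} (suc a) x = sum-point a x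

sum-if : ∀ {r} (s : Fin r → Bool) x y →
         ∑[ c < r ] (if s c then x else y) ≡ count s * x + count (not ∘ s) * y
sum-if {ℕ.zero}  s x y = refl
sum-if {ℕ.suc r} s x y with s zero
... | true  = trans (cong (x +_) (sum-if (s ∘ suc) x y)) (sym (+-assoc x _ _))
... | false = trans (cong (y +_) (sum-if (s ∘ suc) x y)) (x∙yz≈y∙xz y (count (s ∘ suc) * x) _)

weighted-half : ∀ p q x y → p ≡ q ⊎ p ≡ ℕ.suc q → x ≤ y → p * x + q * y ≤ (p + q) * (x + y) / 2
weighted-half p q x y p≈q x≤y =
  subst (_≤ (p + q) * (x + y) / 2) (m*n/n≡m (p * x + q * y) 2) (/-monoˡ-≤ 2 (doubled p≈q))
  where
  doubled : p ≡ q ⊎ p ≡ ℕ.suc q → (p * x + q * y) * 2 ≤ (p + q) * (x + y)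
  doubled (inj₁ refl) = ≤-reflexive (balanced q x y)
    where
    balanced : ∀ q x y → (q * x + q * y) * 2 ≡ (q + q) * (x + y)
    balanced = solve-∀
  doubled (inj₂ refl) =
    subst₂ _≤_ (sym (lhs q x y)) (sym (rhs q x y)) (+-monoʳ-≤ (2 * q * (x + y)) (+-monoʳ-≤ x x≤y))
    where
    lhs : ∀ q x y → (ℕ.suc q * x + q * y) * 2 ≡ 2 * q * (x + y) + (x + x)
    lhs = solve-∀
    rhs : ∀ q x y → (ℕ.suc q + q) * (x + y) ≡ 2 * q * (x + y) + (x + y)
    rhs = solve-∀

deg : ∀ {n} → Graph n → (Fin n → Bool) → Fin n → ℕ
deg G f v = count (λ u → adj G v u ∧ f u)

deg-cong : ∀ {n} (G : Graph n) {f g : Fin n → Bool} → f ≗ g → ∀ v → deg G f v ≡ deg G g v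
deg-cong G f≗g v = count-cong (λ u → cong (adj G v u ∧_) (f≗g u))

-- IsGOA without nonemptiness, for the set on which f is true.
Offensive : ∀ {n} → Graph n → (Fin n → Bool) → Set
Offensive G f = ∀ v → f v ≡ false → deg G (not ∘ f) v + 1 ≤ deg G f v

WeaklyOffensive : ∀ {n} → Graph n → (Fin n → Bool) → Set
WeaklyOffensive G f = ∀ v → f v ≡ false → deg G (not ∘ f) v ≤ deg G f v

Offensive-cong : ∀ {n} (G : Graph n) {f g : Fin n → Bool} → f ≗ g → Offensive G f → Offensive G g
Offensive-cong G f≗g f-offensive v gv≡false =
  subst₂ (λ x y → x + 1 ≤ y) (deg-cong G (cong not ∘ f≗g) v) (deg-cong G f≗g v)
         (f-offensive v (trans (f≗g v) gv≡false))

WeaklyOffensive-cong : ∀ {n} (G : Graph n) {f g : Fin n → Bool} →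
                       f ≗ g → WeaklyOffensive G f → WeaklyOffensive G g
WeaklyOffensive-cong G f≗g f-offensive v gv≡false =
  subst₂ _≤_ (deg-cong G (cong not ∘ f≗g) v) (deg-cong G f≗g v) (f-offensive v (trans (f≗g v) gv≡false))

mem≡lookup : ∀ {n} (S : Subset n) v → mem S v ≡ lookup S v
mem≡lookup S v with lookup S v
... | true  = refl
... | false = refl

mem-∁ : ∀ {n} (S : Subset n) v → mem (∁ S) v ≡ not (mem S v)
mem-∁ S v = trans (mem≡lookup (∁ S) v) (trans (lookup-map v not S) (cong not (sym (mem≡lookup S v))))

mem-tabulate : ∀ {n} (f : Fin n → Bool) v → mem (tabulate f) v ≡ f v
mem-tabulate f v = trans (mem≡lookup (tabulate f) v) (lookup∘tabulate f v)

∈⇒mem≡true : ∀ {n} (S : Subset n) {v} → v ∈ S → mem S v ≡ true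
∈⇒mem≡true S {v} v∈S = trans (mem≡lookup S v) ([]=⇒lookup v∈S)

mem≡true⇒∈ : ∀ {n} (S : Subset n) {v} → mem S v ≡ true → v ∈ S
mem≡true⇒∈ S {v} e = lookup⇒[]= v S (trans (sym (mem≡lookup S v)) e)

mem≡false⇒∉ : ∀ {n} (S : Subset n) {v} → mem S v ≡ false → v ∉ S
mem≡false⇒∉ S e v∈S with trans (sym e) (∈⇒mem≡true S v∈S)
... | ()

∉⇒mem≡false : ∀ {n} (S : Subset n) {v} → v ∉ S → mem S v ≡ false
∉⇒mem≡false S {v} v∉S with mem S v in e
... | true  = ⊥-elim (v∉S (mem≡true⇒∈ S e))
... | false = refl

∣tabulate∣ : ∀ {n} (f : Fin n → Bool) → ∣ tabulate f ∣ ≡ count f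
∣tabulate∣ {ℕ.zero}  f = refl
∣tabulate∣ {ℕ.suc n} f with f zero
... | true  = cong ℕ.suc (∣tabulate∣ (f ∘ suc))
... | false = ∣tabulate∣ (f ∘ suc)

IsGOA⇒Offensive : ∀ {n} (G : Graph n) (S : Subset n) → IsGOA G S → Offensive G (mem S)
IsGOA⇒Offensive G S (_ , S-offensive) v v∉S =
  subst (λ x → x + 1 ≤ δ G S v) (deg-cong G (mem-∁ S) v) (S-offensive v (mem≡false⇒∉ S v∉S))

Offensive⇒IsGOA : ∀ {n} (G : Graph n) {f : Fin n → Bool} →
                  Offensive G f → ∀ {v} → f v ≡ true → IsGOA G (tabulate f)
Offensive⇒IsGOA G {f} f-offensive {v} fv≡true =
  (v , mem≡true⇒∈ (tabulate f) (trans (mem-tabulate f v) fv≡true)) , S-offensive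
  where
  S = tabulate f
  mem-∁S : mem (∁ S) ≗ not ∘ f
  mem-∁S u = trans (mem-∁ S u) (cong not (mem-tabulate f u))
  S-offensive : ∀ u → u ∉ S → δ G (∁ S) u + 1 ≤ δ G S u
  S-offensive u u∉S =
    subst₂ (λ x y → x + 1 ≤ y) (sym (deg-cong G mem-∁S u)) (sym (deg-cong G (mem-tabulate f) u))
           (f-offensive u (trans (sym (mem-tabulate f u)) (∉⇒mem≡false S u∉S)))

deg-□ : ∀ {m n} (G : Graph m) (H : Graph n) (Φ : Fin m × Fin n → Bool) i →
        let (a , b) = remQuot n i in
        deg (G □ H) (Φ ∘ remQuot n) i ≡ deg H (λ d → Φ (a , d)) b + deg G (λ c → Φ (c , b)) a
deg-□ {m} {n} G H Φ i = begin
  count (Ψ ∘ remQuot {m} n)                     ≡⟨ count-remQuot m Ψ ⟩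
  ∑[ c < m ] count (λ d → Ψ (c , d))            ≡⟨ sum-cong-≗ row ⟩
  ∑[ c < m ] (in-copy c + across c)             ≡⟨ ∑-distrib-+ in-copy across ⟩
  ∑[ c < m ] in-copy c + ∑[ c < m ] across c
    ≡⟨ cong₂ _+_ (sum-point a _) (sum-indicator (λ c → adj G a c ∧ Φ (c , b))) ⟩
  deg H (λ d → Φ (a , d)) b + deg G (λ c → Φ (c , b)) a
    ∎
  where
  open ≡-Reasoning
  a = proj₁ (remQuot {m} n i)
  b = proj₂ (remQuot {m} n i)
  -- The first step is definitional: Ψ unfolds the adjacency of G □ H.
  Ψ : Fin m × Fin n → Bool
  Ψ (c , d) = ((does (a ≟ c) ∧ adj H b d) ∨ (adj G a c ∧ does (b ≟ d))) ∧ Φ (c , d)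
  in-copy across : Fin m → ℕ
  in-copy c = if does (a ≟ c) then deg H (λ d → Φ (a , d)) b else 0
  across  c = indicator (adj G a c ∧ Φ (c , b))
  row : ∀ c → count (λ d → Ψ (c , d)) ≡ in-copy c + across c
  row c with a ≟ c
  ... | yes refl rewrite irrefl G a =
    trans (count-cong (λ d → cong (_∧ Φ (a , d)) (∨-identityʳ (adj H b d)))) (sym (+-identityʳ _))
  ... | no _ with adj G a c
  ...   | true  = count-point b (λ d → Φ (c , d))
  ...   | false = count-false n

Offensive-□ : ∀ {m n} (G : Graph m) (H : Graph n) {Φ : Fin m × Fin n → Bool} →
              (∀ a → Offensive H (λ d → Φ (a , d))) → (∀ b → WeaklyOffensive G (λ c → Φ (c , b))) →
              Offensive (G □ H) (Φ ∘ remQuot n)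
Offensive-□ {m} {n} G H {Φ} rows columns i Φi≡false = begin
  deg (G □ H) ((not ∘ Φ) ∘ remQuot {m} n) i + 1
    ≡⟨ cong (_+ 1) (deg-□ G H (not ∘ Φ) i) ⟩
  deg H (λ d → not (Φ (a , d))) b + deg G (λ c → not (Φ (c , b))) a + 1
    ≡⟨ xy∙z≈xz∙y (deg H (λ d → not (Φ (a , d))) b) _ 1 ⟩
  deg H (λ d → not (Φ (a , d))) b + 1 + deg G (λ c → not (Φ (c , b))) a
    ≤⟨ +-mono-≤ (rows a b Φi≡false) (columns b a Φi≡false) ⟩
  deg H (λ d → Φ (a , d)) b + deg G (λ c → Φ (c , b)) a
    ≡⟨ deg-□ G H Φ i ⟨
  deg (G □ H) (Φ ∘ remQuot {m} n) i
    ∎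
  where
  open ≤-Reasoning
  a = proj₁ (remQuot {m} n i)
  b = proj₂ (remQuot {m} n i)

count≡self+deg-complete : ∀ {r} (f : Fin r → Bool) a → count f ≡ indicator (f a) + deg (complete r) f a
count≡self+deg-complete f zero    = refl
count≡self+deg-complete f (suc a) =
  trans (cong (indicator (f zero) +_) (count≡self+deg-complete (f ∘ suc) a))
        (x∙yz≈y∙xz (indicator (f zero)) (indicator (f (suc a))) _)

WeaklyOffensive-complete : ∀ {r} {f : Fin r → Bool} →
                           count (not ∘ f) ≤ ℕ.suc (count f) → WeaklyOffensive (complete r) f
WeaklyOffensive-complete {r} {f} balanced a fa≡false = ≤-pred (begin
  ℕ.suc (deg (complete r) (not ∘ f) a)
    ≡⟨ cong (λ x → indicator (not x) + deg (complete r) (not ∘ f) a) fa≡false ⟨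
  indicator (not (f a)) + deg (complete r) (not ∘ f) a
    ≡⟨ count≡self+deg-complete (not ∘ f) a ⟨
  count (not ∘ f)
    ≤⟨ balanced ⟩
  ℕ.suc (count f)
    ≡⟨ cong ℕ.suc (count≡self+deg-complete f a) ⟩
  ℕ.suc (indicator (f a) + deg (complete r) f a)
    ≡⟨ cong (λ x → ℕ.suc (indicator x + deg (complete r) f a)) fa≡false ⟩
  ℕ.suc (deg (complete r) f a)
    ∎)
  where open ≤-Reasoning

alternate : ∀ {r} → Fin r → Bool
alternate zero    = false
alternate (suc c) = not (alternate c)

count-alternate : ∀ r → count (not ∘ alternate {r}) ≡ count (alternate {r})
                      ⊎ count (not ∘ alternate {r}) ≡ ℕ.suc (count (alternate {r}))
count-alternate ℕ.zero = inj₁ refl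
count-alternate (ℕ.suc r) with count-alternate r | count-cong (not-involutive ∘ alternate {r})
... | inj₁ balanced | not-not = inj₂ (cong ℕ.suc (trans not-not (sym balanced)))
... | inj₂ one-more | not-not = inj₁ (trans (cong ℕ.suc not-not) (sym one-more))

alternate-weaklyOffensive : ∀ r → WeaklyOffensive (complete r) alternate
                                × WeaklyOffensive (complete r) (not ∘ alternate)
alternate-weaklyOffensive r =
  WeaklyOffensive-complete evens≤1+odds ,
  WeaklyOffensive-complete (subst (_≤ ℕ.suc evens) (sym not-not-alternate) odds≤1+evens)
  where
  evens odds : ℕ
  evens = count (not ∘ alternate {r})
  odds  = count (alternate {r})
  not-not-alternate : count (not ∘ not ∘ alternate {r}) ≡ odds
  not-not-alternate = count-cong (not-involutive ∘ alternate {r})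
  evens≤1+odds : evens ≤ ℕ.suc odds
  evens≤1+odds with count-alternate r
  ... | inj₁ balanced = subst (_≤ ℕ.suc odds) (sym balanced) (n≤1+n odds)
  ... | inj₂ one-more = ≤-reflexive one-more
  odds≤1+evens : odds ≤ ℕ.suc evens
  odds≤1+evens with count-alternate r
  ... | inj₁ balanced = subst (_≤ ℕ.suc evens) balanced (n≤1+n evens)
  ... | inj₂ one-more = ≤-trans (n≤1+n odds) (≤-trans (≤-reflexive (sym one-more)) (n≤1+n evens))

record OffensivePartition {n} (H : Graph n) (w : Fin n → Bool) : Set where
  field
    offensive       : Offensive H w
    offensive-compl : Offensive H (not ∘ w)
    inside          : ∃ λ v → w v ≡ true
    outside         : ∃ λ v → w v ≡ false

module _ {n} {H : Graph n} where

  partition⇒OffensivePartition : PartitionableIntoTwoGOA H → ∃ (OffensivePartition H)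
  partition⇒OffensivePartition (Y , Y-goa , ∁Y-goa) = mem Y , record
    { offensive       = IsGOA⇒Offensive H Y Y-goa
    ; offensive-compl = Offensive-cong H (mem-∁ Y) (IsGOA⇒Offensive H (∁ Y) ∁Y-goa)
    ; inside          = map₂ (∈⇒mem≡true Y) (proj₁ Y-goa)
    ; outside         = map₂ (λ v∈∁Y → not-injective (trans (sym (mem-∁ Y _)) (∈⇒mem≡true (∁ Y) v∈∁Y)))
                             (proj₁ ∁Y-goa)
    }

  OffensivePartition-swap : ∀ {w} → OffensivePartition H w → OffensivePartition H (not ∘ w)
  OffensivePartition-swap {w} P = record
    { offensive       = offensive-compl
    ; offensive-compl = Offensive-cong H (sym ∘ not-involutive ∘ w) offensive
    ; inside          = map₂ (cong not) outside
    ; outside         = map₂ (cong not) inside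
    }
    where open OffensivePartition P

  smaller-side : ∀ {w} → OffensivePartition H w →
                 ∃ λ w′ → OffensivePartition H w′ × count w′ ≤ count (not ∘ w′)
  smaller-side {w} P with count w ≤? count (not ∘ w)
  ... | yes w-smaller = w , P , w-smaller
  ... | no  w-larger  = not ∘ w , OffensivePartition-swap P ,
                        subst (count (not ∘ w) ≤_) (sym (count-cong (not-involutive ∘ w))) (≰⇒≥ w-larger)

module Stacked {n} {H : Graph n} {w : Fin n → Bool} (P : OffensivePartition H w) (r : ℕ) where
  open OffensivePartition P

  stacked : Fin r × Fin n → Bool
  stacked (c , d) = alternate c xor w d

  stacked-offensive : Offensive (complete r □ H) (stacked ∘ remQuot n)
  stacked-offensive = Offensive-□ (complete r) H rows columns
    where
    rows : ∀ a → Offensive H (λ d → alternate a xor w d)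
    rows a with alternate a
    ... | false = offensive
    ... | true  = offensive-compl
    column : ∀ b → WeaklyOffensive (complete r) (λ c → w b xor alternate c)
    column b with w b
    ... | false = proj₁ (alternate-weaklyOffensive r)
    ... | true  = proj₂ (alternate-weaklyOffensive r)
    columns : ∀ b → WeaklyOffensive (complete r) (λ c → alternate c xor w b)
    columns b = WeaklyOffensive-cong (complete r) (λ c → xor-comm (w b) (alternate c)) (column b)

  stacked-nonempty : Fin r → ∃ λ v → stacked (remQuot n v) ≡ true
  stacked-nonempty a =
    let (d , a,d∈stacked) = row-nonempty
    in combine a d , trans (cong stacked (remQuot-combine a d)) a,d∈stacked
    where
    row-nonempty : ∃ λ d → stacked (a , d) ≡ true
    row-nonempty with alternate a
    ... | false = inside
    ... | true  = map₂ (cong not) outside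

  count-stacked : count (stacked ∘ remQuot n)
                  ≡ count (not ∘ alternate {r}) * count w + count (alternate {r}) * count (not ∘ w)
  count-stacked = begin
    count (stacked ∘ remQuot n)
      ≡⟨ count-remQuot r stacked ⟩
    ∑[ c < r ] count (λ d → alternate c xor w d)
      ≡⟨ sum-cong-≗ row-size ⟩
    ∑[ c < r ] (if alternate c then count (not ∘ w) else count w)
      ≡⟨ sum-if (alternate {r}) _ _ ⟩
    count (alternate {r}) * count (not ∘ w) + count (not ∘ alternate {r}) * count w
      ≡⟨ +-comm (count (alternate {r}) * count (not ∘ w)) _ ⟩
    count (not ∘ alternate {r}) * count w + count (alternate {r}) * count (not ∘ w)
      ∎
    where
    open ≡-Reasoning
    row-size : ∀ (c : Fin r) →
               count (λ d → alternate c xor w d) ≡ (if alternate c then count (not ∘ w) else count w)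
    row-size c with alternate c
    ... | true  = refl
    ... | false = refl

  count-stacked-≤ : count w ≤ count (not ∘ w) → count (stacked ∘ remQuot n) ≤ (r * n) / 2
  count-stacked-≤ w-smaller = begin
    count (stacked ∘ remQuot n)
      ≡⟨ count-stacked ⟩
    count (not ∘ alternate {r}) * count w + count (alternate {r}) * count (not ∘ w)
      ≤⟨ weighted-half _ _ _ _ (count-alternate r) w-smaller ⟩
    (count (not ∘ alternate {r}) + count (alternate {r})) * (count w + count (not ∘ w)) / 2
      ≡⟨ cong₂ (λ x y → x * y / 2) r-copies (count-compl w) ⟩
    r * n / 2
      ∎
    where
    open ≤-Reasoning
    r-copies : count (not ∘ alternate {r}) + count (alternate {r}) ≡ r
    r-copies = trans (+-comm (count (not ∘ alternate {r})) _) (count-compl (alternate {r}))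

  γo≤-stacked : Fin r → count w ≤ count (not ∘ w) → γo≤ (complete r □ H) ((r * n) / 2)
  γo≤-stacked a w-smaller =
    tabulate (stacked ∘ remQuot n) ,
    Offensive⇒IsGOA (complete r □ H) stacked-offensive (proj₂ (stacked-nonempty a)) ,
    subst (_≤ (r * n) / 2) (sym (∣tabulate∣ (stacked ∘ remQuot n))) (count-stacked-≤ w-smaller)

theorem11 : (n r : ℕ) → 1 ≤ r → (H : Graph n) → PartitionableIntoTwoGOA H →
    γo≤ (complete r □ H) ((r * n) / 2)
theorem11 n r 1≤r H partition =
  let (_ , P)           = partition⇒OffensivePartition {H = H} partition
      (_ , P′ , smaller) = smaller-side P
  in Stacked.γo≤-stacked P′ r (fromℕ< 1≤r) smaller
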